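{- Let $n,k$ be integers with $1\le k\le n-1$. The Johnson graph $J(n,k)$ is periodic if and only if it is isomorphic to one of $J(2,1)$, $J(3,1)$, $J(4,2)$; equivalently, if and only if $(n,k)\in\{(2,1),(3,1),(3,2),(4,2)\}$.
   Context: The Johnson graph $J(n,k)$ has as vertices the $k$-element subsets of an $n$-element set, two vertices $x,y$ being adjacent iff $|x\cap y|=k-1$. For a finite simple graph $G=(V,E)$, let $\mathcal{A}(G)=\{(u,v),(v,u) : uv\in E\}$ be its set of symmetric arcs; for an arc $e=(u,v)$ write $o(e)=u$, $t(e)=v$, $e^{ -1}=(v,u)$. The Grover transfer matrix $U=U(G)$ is indexed by $\mathcal{A}(G)$ with $U_{e,f}=2/\deg(t(f))$ if $t(f)=o(e)$ and $e\neq f^{ -1}$; $U_{e,f}=2/\deg(t(f))-1$ if $e=f^{ -1}$; $U_{e,f}=0$ otherwise. $G$ is periodic if $U^k=I$ for some positive integer $k$. -}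

module Defs where

open import Data.Bool using (Bool; true; false; if_then_else_; _∧_; not)
open import Data.Nat as ℕ using (ℕ; zero; suc; _∸_)
open import Data.Integer using (+_)
open import Data.Rational as ℚ using (ℚ; 0ℚ; 1ℚ)
open import Data.List using (List; []; _∷_; _++_; map; foldr; length; filterᵇ; cartesianProduct)
open import Data.List.Membership.Propositional using (_∈_)
open import Data.Product using (_×_; _,_; proj₁; proj₂; Σ; ∃)
open import Data.Vec using (Vec; []; _∷_)
import Data.Vec.Properties as VecP
open import Data.Fin.Subset using (Subset; _∩_; ∣_∣)
open import Relation.Nullary.Decidable using (⌊_⌋)
open import Relation.Binary.PropositionalEquality using (_≡_)
open import Relation.Binary.Definitions using (DecidableEquality)
import Data.Bool.Properties as BoolP
import Data.Product.Properties as ProdP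

-- A finite simple graph: a vertex type with decidable equality, a list
-- enumerating the vertex set (without repetition), and a (symmetric,
-- irreflexive) Boolean adjacency relation.
record FinGraph : Set₁ where
  field
    V     : Set
    _≟V_  : DecidableEquality V
    verts : List V
    adj   : V → V → Bool

module _ (G : FinGraph) where
  open FinGraph G

  Arc : Set
  Arc = V × V

  arcs : List Arc
  arcs = filterᵇ (λ e → adj (proj₁ e) (proj₂ e)) (cartesianProduct verts verts)

  o t : Arc → V
  o = proj₁
  t = proj₂

  _⁻¹ : Arc → Arc
  (u , v) ⁻¹ = (v , u)

  deg : V → ℕ
  deg v = length (filterᵇ (adj v) verts)

  -- 2 / deg v  (deg v ≥ 1 whenever v is the terminus of an arc; 0 otherwise)
  twoOverDeg : V → ℚ
  twoOverDeg v with deg v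
  ... | zero  = 0ℚ
  ... | suc d = (+ 2) ℚ./ suc d

  _≟A_ : DecidableEquality Arc
  _≟A_ = ProdP.≡-dec _≟V_ _≟V_

  U : Arc → Arc → ℚ
  U e f =
    if ⌊ t f ≟V o e ⌋
    then (if ⌊ e ≟A (f ⁻¹) ⌋ then twoOverDeg (t f) ℚ.- 1ℚ else twoOverDeg (t f))
    else 0ℚ

  Matrix : Set
  Matrix = Arc → Arc → ℚ

  I : Matrix
  I e f = if ⌊ e ≟A f ⌋ then 1ℚ else 0ℚ

  _⊗_ : Matrix → Matrix → Matrix
  (A ⊗ B) e f = foldr ℚ._+_ 0ℚ (map (λ g → A e g ℚ.* B g f) arcs)

  _^_ : Matrix → ℕ → Matrix
  A ^ zero  = I
  A ^ suc m = A ⊗ (A ^ m)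

  Periodic : Set
  Periodic = ∃ λ m → 1 ℕ.≤ m × (∀ e f → e ∈ arcs → f ∈ arcs → (U ^ m) e f ≡ I e f)

allSubsets : (n : ℕ) → List (Subset n)
allSubsets zero    = [] ∷ []
allSubsets (suc n) = map (false ∷_) (allSubsets n) ++ map (true ∷_) (allSubsets n)

-- Johnson graph J(n,k): vertices the k-subsets of Fin n,
-- x ~ y iff |x ∩ y| = k - 1 (and x ≠ y; automatic when k ≥ 1)
Johnson : ℕ → ℕ → FinGraph
Johnson n k = record
  { V     = Subset n
  ; _≟V_  = VecP.≡-dec BoolP._≟_
  ; verts = filterᵇ (λ x → ⌊ ∣ x ∣ ℕ.≟ k ⌋) (allSubsets n)
  ; adj   = λ x y → ⌊ ∣ x ∩ y ∣ ℕ.≟ k ∸ 1 ⌋ ∧ not ⌊ VecP.≡-dec BoolP._≟_ x y ⌋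
  }

-- Let D = k(n − k) be the common degree of J(n,k). If φ is an eigenfunction of the
-- adjacency operator with eigenvalue θ, its pull-backs along the origins and the termini
-- of arcs span a U-invariant plane on which U acts as the companion matrix of
-- x² − μx + 1, where μ = 2θ/D, so Uᵐ acts there through Chebyshev polynomials in μ.
-- Given one arc along which φ is constant and nonzero and another along which it is not
-- constant, periodicity makes such a polynomial vanish at μ, which for rational μ
-- forces μ ∈ ℤ. For φ(w) = n·[0 ∈ w] − k one has θ = D − n, and μ ∈ ℤ means D ∣ 2n,
-- leaving (n,k) ∈ {(2,1), (3,1), (3,2), (4,2), (8,4), (9,3), (9,6)}. A second
-- eigenfunction excludes the last three; the first four are periodic by computation
-- (U² = I, U³ = I, U³ = I and U¹² = I).

module Submission where

open import Defs
open import Data.Bool using (Bool; true; false; if_then_else_; _∧_)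
import Data.Bool.Properties as Bool
open import Data.Empty using (⊥-elim)
open import Data.Fin using (Fin; toℕ; fromℕ<; #_)
open import Data.Fin.Properties using (all?; toℕ-fromℕ<)
open import Data.Fin.Subset using (Subset; _∩_; _∪_; ∣_∣; ⁅_⁆)
import Data.Fin.Subset.Properties as Subset
open import Data.Integer as ℤ using (ℤ; +_)
import Data.Integer.Divisibility.Signed as ℤ
import Data.Integer.Properties as ℤ
import Data.Integer.Solver as ℤ-Solver
open import Data.List using (List; []; _∷_; _++_; map; foldr; length; filterᵇ; cartesianProduct)
open import Data.List.Membership.Propositional using (_∈_)
open import Data.List.Membership.Propositional.Properties
  using (∈-filter⁻; ∈-filter⁺; ∈-map⁺; ∈-map⁻; ∈-++⁺ˡ; ∈-++⁺ʳ; ∈-cartesianProductWith⁻; ∈-cartesianProductWith⁺)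
open import Data.List.Properties using (map-cong)
open import Data.List.Relation.Unary.All as All using (All; [])
open import Data.List.Relation.Unary.AllPairs using ([]; _∷_)
open import Data.List.Relation.Unary.Any using (here; there)
open import Data.List.Relation.Unary.Unique.Propositional using (Unique)
import Data.List.Relation.Unary.Unique.Propositional.Properties as Unique
open import Data.Nat as ℕ using (ℕ; zero; suc; _≤_; _<_; _∸_; _≡ᵇ_; s≤s; z≤n)
open import Data.Nat.Coprimality as Coprimality using (Coprime; coprime-divisor)
open import Data.Nat.Divisibility using (_∣_; _∣?_; divides; ∣1⇒≡1; ∣-trans; ∣⇒≤; n∣m*n; ∣m+n∣m⇒∣n)
import Data.Nat.Properties as ℕ
import Data.Nat.Solver as ℕ-Solver
open import Data.Product using (_×_; _,_; proj₁; proj₂; ∃-syntax)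
import Data.Product.Properties as Product
open import Data.Rational using (ℚ; mkℚ; 0ℚ; 1ℚ; _+_; _*_; _-_; -_; _/_; 1/_; ↥_; ↧_; ≢-nonZero)
import Data.Rational.Properties as ℚ
import Data.Rational.Solver as ℚ-Solver
import Data.Rational.Unnormalised as ℚᵘ
import Data.Rational.Unnormalised.Properties as ℚᵘ
open import Data.Sum using (_⊎_; inj₁; inj₂; [_,_])
open import Data.Vec using (_∷_; []; head)
import Data.Vec.Properties as Vec
open import Function using (id; _∘_)
open import Function.Bundles using (_⇔_; mk⇔; Equivalence)
open import Relation.Binary.Definitions using (DecidableEquality)
open import Relation.Binary.PropositionalEquality hiding ([_])
open import Relation.Nullary using (Dec; yes; no; ¬_)
open import Relation.Nullary.Decidable
  using (⌊_⌋; T?; True; isYes≗does; dec-true; dec-false; toWitness; fromWitness; from-yes; _→-dec_; _⊎-dec_)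
open import Algebra.Properties.Group ℚ.+-0-group using (x∙y⁻¹≈ε⇒x≈y)

if-yes : ∀ {P A : Set} (d : Dec P) {a b : A} → P → (if ⌊ d ⌋ then a else b) ≡ a
if-yes (yes _) p = refl
if-yes (no ¬p) p = ⊥-elim (¬p p)

if-no : ∀ {P A : Set} (d : Dec P) {a b : A} → ¬ P → (if ⌊ d ⌋ then a else b) ≡ b
if-no (yes p) ¬p = ⊥-elim (¬p p)
if-no (no _) ¬p = refl

∑ : ∀ {A : Set} → List A → (A → ℚ) → ℚ
∑ xs f = foldr _+_ 0ℚ (map f xs)

syntax ∑ xs (λ x → e) = ∑[ x ∈ xs ] e

module _ {A : Set} where

  ∑-cong : ∀ (xs : List A) {f g : A → ℚ} → (∀ x → x ∈ xs → f x ≡ g x) → ∑ xs f ≡ ∑ xs g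
  ∑-cong []       eq = refl
  ∑-cong (x ∷ xs) eq = cong₂ _+_ (eq x (here refl)) (∑-cong xs (λ y y∈ → eq y (there y∈)))

  ∑-cong′ : ∀ (xs : List A) {f g : A → ℚ} → (∀ x → f x ≡ g x) → ∑ xs f ≡ ∑ xs g
  ∑-cong′ xs eq = ∑-cong xs (λ x _ → eq x)

  ∑-zero : ∀ (xs : List A) → ∑[ x ∈ xs ] 0ℚ ≡ 0ℚ
  ∑-zero []       = refl
  ∑-zero (x ∷ xs) = trans (ℚ.+-identityˡ _) (∑-zero xs)

  ∑-+ : ∀ (xs : List A) (f g : A → ℚ) → ∑[ x ∈ xs ] (f x + g x) ≡ ∑ xs f + ∑ xs g
  ∑-+ []       f g = refl
  ∑-+ (x ∷ xs) f g rewrite ∑-+ xs f g =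
    solve 4 (λ a b c d → (a :+ b) :+ (c :+ d) := (a :+ c) :+ (b :+ d)) refl (f x) (g x) (∑ xs f) (∑ xs g)
    where open ℚ-Solver.+-*-Solver

  ∑-*ˡ : ∀ (xs : List A) c (f : A → ℚ) → ∑[ x ∈ xs ] (c * f x) ≡ c * ∑ xs f
  ∑-*ˡ []       c f = sym (ℚ.*-zeroʳ c)
  ∑-*ˡ (x ∷ xs) c f rewrite ∑-*ˡ xs c f = sym (ℚ.*-distribˡ-+ c (f x) (∑ xs f))

  ∑-*ʳ : ∀ (xs : List A) c (f : A → ℚ) → ∑[ x ∈ xs ] (f x * c) ≡ ∑ xs f * c
  ∑-*ʳ xs c f = trans (∑-cong′ xs (λ x → ℚ.*-comm (f x) c))
                      (trans (∑-*ˡ xs c f) (ℚ.*-comm c (∑ xs f)))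

  ∑-neg : ∀ (xs : List A) (f : A → ℚ) → ∑[ x ∈ xs ] (- f x) ≡ - ∑ xs f
  ∑-neg []       f = refl
  ∑-neg (x ∷ xs) f rewrite ∑-neg xs f = sym (ℚ.neg-distrib-+ (f x) (∑ xs f))

  ∑-++ : ∀ (xs : List A) ys (f : A → ℚ) → ∑ (xs ++ ys) f ≡ ∑ xs f + ∑ ys f
  ∑-++ []       ys f = sym (ℚ.+-identityˡ _)
  ∑-++ (x ∷ xs) ys f rewrite ∑-++ xs ys f = sym (ℚ.+-assoc (f x) (∑ xs f) (∑ ys f))

  ∑-filterᵇ : ∀ (p : A → Bool) (xs : List A) (f : A → ℚ) →
              ∑ (filterᵇ p xs) f ≡ ∑[ x ∈ xs ] (if p x then f x else 0ℚ)
  ∑-filterᵇ p []       f = refl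
  ∑-filterᵇ p (x ∷ xs) f with p x
  ... | true  = cong (λ y → f x + y) (∑-filterᵇ p xs f)
  ... | false = trans (∑-filterᵇ p xs f) (sym (ℚ.+-identityˡ _))

  ∑-if-const : ∀ (xs : List A) (p : A → Bool) c → ∑[ x ∈ xs ] (if p x then c else 0ℚ) ≡ c * ∑[ x ∈ xs ] (if p x then 1ℚ else 0ℚ)
  ∑-if-const xs p c = trans (∑-cong′ xs scale) (∑-*ˡ xs c _)
    where
    scale : ∀ x → (if p x then c else 0ℚ) ≡ c * (if p x then 1ℚ else 0ℚ)
    scale x with p x
    ... | true  = sym (ℚ.*-identityʳ c)
    ... | false = sym (ℚ.*-zeroʳ c)

  ∑-select : (_≟_ : DecidableEquality A) → ∀ (xs : List A) → Unique xs → ∀ {a} → a ∈ xs → (f : A → ℚ) →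
             ∑[ x ∈ xs ] (if ⌊ x ≟ a ⌋ then f x else 0ℚ) ≡ f a
  ∑-select _≟_ (x ∷ xs) (x∉xs ∷ _) {a} (here refl) f =
    trans (cong₂ _+_ (if-yes (a ≟ a) refl)
                     (trans (∑-cong xs (λ y y∈ → if-no (y ≟ a) (λ y≡a → All.lookup x∉xs y∈ (sym y≡a))))
                            (∑-zero xs)))
          (ℚ.+-identityʳ (f a))
  ∑-select _≟_ (x ∷ xs) (x∉xs ∷ xs!) {a} (there a∈) f =
    trans (cong₂ _+_ (if-no (x ≟ a) (λ x≡a → All.lookup x∉xs a∈ x≡a)) (∑-select _≟_ xs xs! a∈ f))
          (ℚ.+-identityˡ (f a))

  ∑-map : ∀ {B : Set} (g : B → A) (xs : List B) (f : A → ℚ) → ∑ (map g xs) f ≡ ∑[ x ∈ xs ] f (g x)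
  ∑-map g []       f = refl
  ∑-map g (x ∷ xs) f = cong (λ y → f (g x) + y) (∑-map g xs f)

module _ {A B : Set} where

  ∑-comm : ∀ (xs : List A) (ys : List B) (f : A → B → ℚ) →
           ∑[ x ∈ xs ] ∑[ y ∈ ys ] f x y ≡ ∑[ y ∈ ys ] ∑[ x ∈ xs ] f x y
  ∑-comm []       ys f = sym (∑-zero ys)
  ∑-comm (x ∷ xs) ys f rewrite ∑-comm xs ys f = sym (∑-+ ys (f x) (λ y → ∑[ x ∈ xs ] f x y))

  ∑-cartesianProduct : ∀ (xs : List A) (ys : List B) (f : A × B → ℚ) →
                       ∑ (cartesianProduct xs ys) f ≡ ∑[ x ∈ xs ] ∑[ y ∈ ys ] f (x , y)
  ∑-cartesianProduct []       ys f = refl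
  ∑-cartesianProduct (x ∷ xs) ys f =
    trans (∑-++ (map (x ,_) ys) _ f)
          (cong₂ _+_ (∑-map (x ,_) ys f) (∑-cartesianProduct xs ys f))

fromℤ : ℤ → ℚ
fromℤ z = mkℚ z 0 (Coprimality.sym (Coprimality.1-coprimeTo ℤ.∣ z ∣))

fromℤ-injective : ∀ {a b} → fromℤ a ≡ fromℤ b → a ≡ b
fromℤ-injective = cong ↥_

denominator-1≡0⇒≡fromℤ : ∀ t → ℚ.denominator-1 t ≡ 0 → t ≡ fromℤ (↥ t)
denominator-1≡0⇒≡fromℤ (mkℚ _ zero _) refl = refl

fromℤ-+ : ∀ a b → fromℤ (a ℤ.+ b) ≡ fromℤ a + fromℤ b
fromℤ-+ a b = ℚ.toℚᵘ-injective
  (ℚᵘ.≃-trans (ℚᵘ.*≡* (cong (ℤ._* + 1) (sym (cong₂ ℤ._+_ (ℤ.*-identityʳ a) (ℤ.*-identityʳ b)))))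
              (ℚᵘ.≃-sym (ℚ.toℚᵘ-homo-+ (fromℤ a) (fromℤ b))))

fromℤ-* : ∀ a b → fromℤ (a ℤ.* b) ≡ fromℤ a * fromℤ b
fromℤ-* a b = ℚ.toℚᵘ-injective (ℚᵘ.≃-sym (ℚ.toℚᵘ-homo-* (fromℤ a) (fromℤ b)))

fromℤ-neg : ∀ a → fromℤ (ℤ.- a) ≡ - fromℤ a
fromℤ-neg ℤ.-[1+ n ] = refl
fromℤ-neg (+ zero)   = refl
fromℤ-neg (+ suc n)  = refl

fromℤ-- : ∀ a b → fromℤ (a ℤ.- b) ≡ fromℤ a - fromℤ b
fromℤ-- a b = trans (fromℤ-+ a (ℤ.- b)) (cong (λ x → fromℤ a + x) (fromℤ-neg b))

*-denominator : ∀ t → t * fromℤ (↧ t) ≡ fromℤ (↥ t)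
*-denominator t@(mkℚ p d _) = ℚ.toℚᵘ-injective
  (ℚᵘ.≃-trans (ℚ.toℚᵘ-homo-* t (fromℤ (↧ t)))
              (ℚᵘ.*≡* (trans (ℤ.*-identityʳ _) (cong (λ e → p ℤ.* + suc e) (sym (ℕ.*-identityʳ d))))))

/-*-denominator : ∀ i d → (i / suc d) * fromℤ (+ suc d) ≡ fromℤ i
/-*-denominator i d = ℚ.toℚᵘ-injective
  (ℚᵘ.≃-trans (ℚ.toℚᵘ-homo-* (i / suc d) (fromℤ (+ suc d)))
  (ℚᵘ.≃-trans (ℚᵘ.*-congʳ (ℚ.toℚᵘ-fromℚᵘ (ℚᵘ.mkℚᵘ i d)))
              (ℚᵘ.*≡* (trans (ℤ.*-identityʳ _) (cong (λ e → i ℤ.* + suc e) (sym (ℕ.*-identityʳ d)))))))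

fromℕ : ℕ → ℚ
fromℕ zero    = 0ℚ
fromℕ (suc n) = 1ℚ + fromℕ n

fromℕ≡fromℤ : ∀ n → fromℕ n ≡ fromℤ (+ n)
fromℕ≡fromℤ zero    = refl
fromℕ≡fromℤ (suc n) = trans (cong (λ x → 1ℚ + x) (fromℕ≡fromℤ n)) (sym (fromℤ-+ (+ 1) (+ n)))

fromℕ-injective : ∀ {m n} → fromℕ m ≡ fromℕ n → m ≡ n
fromℕ-injective {m} {n} eq = ℤ.+-injective (fromℤ-injective (trans (sym (fromℕ≡fromℤ m)) (trans eq (fromℕ≡fromℤ n))))

fromℕ-* : ∀ m n → fromℕ (m ℕ.* n) ≡ fromℕ m * fromℕ n
fromℕ-* m n = begin
  fromℕ (m ℕ.* n)              ≡⟨ fromℕ≡fromℤ (m ℕ.* n) ⟩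
  fromℤ (+ (m ℕ.* n))          ≡⟨ cong fromℤ (ℤ.pos-* m n) ⟩
  fromℤ (+ m ℤ.* + n)          ≡⟨ fromℤ-* (+ m) (+ n) ⟩
  fromℤ (+ m) * fromℤ (+ n)    ≡⟨ cong₂ _*_ (fromℕ≡fromℤ m) (fromℕ≡fromℤ n) ⟨
  fromℕ m * fromℕ n            ∎
  where open ≡-Reasoning

fromℕ-∸ : ∀ m n → n ≤ m → fromℕ (m ∸ n) ≡ fromℕ m - fromℕ n
fromℕ-∸ m       zero    _         = sym (ℚ.+-identityʳ (fromℕ m))
fromℕ-∸ (suc m) (suc n) (s≤s n≤m) = trans (fromℕ-∸ m n n≤m) (solve 2 (λ x y → x :- y := (con 1ℚ :+ x) :- (con 1ℚ :+ y)) refl (fromℕ m) (fromℕ n))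
  where open ℚ-Solver.+-*-Solver

x≢0∧x*y≡0⇒y≡0 : ∀ x y → x ≢ 0ℚ → x * y ≡ 0ℚ → y ≡ 0ℚ
x≢0∧x*y≡0⇒y≡0 x y x≢0 x*y≡0 = begin
  y                 ≡⟨ ℚ.*-identityˡ y ⟨
  1ℚ * y            ≡⟨ cong (_* y) (ℚ.*-inverseˡ x) ⟨
  1/ x * x * y      ≡⟨ ℚ.*-assoc (1/ x) x y ⟩
  1/ x * (x * y)    ≡⟨ cong (1/ x *_) x*y≡0 ⟩
  1/ x * 0ℚ         ≡⟨ ℚ.*-zeroʳ (1/ x) ⟩
  0ℚ                ∎
  where open ≡-Reasoning
        instance _ = ≢-nonZero x≢0

-- Chebyshev polynomials at rational points

-- chebyshev t m = Uₘ₋₁(t/2), with Uⱼ the Chebyshev polynomials of the second kind.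
chebyshev : ℚ → ℕ → ℚ
chebyshev t zero          = 0ℚ
chebyshev t (suc zero)    = 1ℚ
chebyshev t (suc (suc m)) = t * chebyshev t (suc m) - chebyshev t m

-- For t = p/q, qᵐ · chebyshev t (m + 1) is the integer scaled (m + 1), which is ≡ pᵐ modulo q;
-- so when p and q > 1 are coprime it cannot vanish.
module ScaledChebyshev (p q : ℤ) where

  scaled : ℕ → ℤ
  scaled zero          = + 0
  scaled (suc zero)    = + 1
  scaled (suc (suc m)) = p ℤ.* scaled (suc m) ℤ.- q ℤ.* (q ℤ.* scaled m)

  scaled≡pow-mod : ∀ m → q ℤ.∣ scaled (suc m) ℤ.- p ℤ.^ m
  scaled≡pow-mod zero    = ℤ.divides (+ 0) (sym (ℤ.*-zeroˡ q))
  scaled≡pow-mod (suc m) =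
    subst (q ℤ.∣_) (recurrence p q (scaled (suc m)) (scaled m) (p ℤ.^ m))
          (ℤ.∣m∣n⇒∣m-n (ℤ.∣n⇒∣m*n p (scaled≡pow-mod m)) (ℤ.∣m⇒∣m*n (q ℤ.* scaled m) ℤ.∣-refl))
    where
    open ℤ-Solver.+-*-Solver
    recurrence : ∀ p q r₁ r₀ x → p ℤ.* (r₁ ℤ.- x) ℤ.- q ℤ.* (q ℤ.* r₀) ≡ p ℤ.* r₁ ℤ.- q ℤ.* (q ℤ.* r₀) ℤ.- p ℤ.* x
    recurrence = solve 5 (λ p q r₁ r₀ x → p :* (r₁ :- x) :- q :* (q :* r₀) := p :* r₁ :- q :* (q :* r₀) :- p :* x) refl

  fromℤ-scaled-step : ∀ a b → fromℤ (p ℤ.* a ℤ.- q ℤ.* (q ℤ.* b)) ≡ fromℤ p * fromℤ a - fromℤ q * (fromℤ q * fromℤ b)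
  fromℤ-scaled-step a b =
    trans (fromℤ-- (p ℤ.* a) _)
          (cong₂ _-_ (fromℤ-* p a) (trans (fromℤ-* q _) (cong (fromℤ q *_) (fromℤ-* q b))))

  chebyshev-scaled : ∀ t → t * fromℤ q ≡ fromℤ p → ∀ m → chebyshev t (suc m) * fromℤ (q ℤ.^ m) ≡ fromℤ (scaled (suc m))
  chebyshev-scaled t tq≡p zero          = ℚ.*-identityˡ _
  chebyshev-scaled t tq≡p (suc zero)    = begin
    (t * 1ℚ - 0ℚ) * fromℤ (q ℤ.* + 1)          ≡⟨ cong ((t * 1ℚ - 0ℚ) *_) (fromℤ-* q (+ 1)) ⟩
    (t * 1ℚ - 0ℚ) * (Q * 1ℚ)                   ≡⟨ solve 2 (λ t Q → (t :* con 1ℚ :- con 0ℚ) :* (Q :* con 1ℚ) := t :* Q) refl t Q ⟩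
    t * Q                                      ≡⟨ tq≡p ⟩
    P                                          ≡⟨ solve 2 (λ P Q → P := P :* con 1ℚ :- Q :* (Q :* con 0ℚ)) refl P Q ⟩
    P * 1ℚ - Q * (Q * 0ℚ)                      ≡⟨ sym (fromℤ-scaled-step (+ 1) (+ 0)) ⟩
    fromℤ (scaled 2)                           ∎
    where open ≡-Reasoning
          open ℚ-Solver.+-*-Solver
          P = fromℤ p
          Q = fromℤ q
  chebyshev-scaled t tq≡p (suc (suc m)) = begin
    (t * s₂ - s₁) * fromℤ (q ℤ.* (q ℤ.* qᵐ))   ≡⟨ cong ((t * s₂ - s₁) *_) (trans (fromℤ-* q _) (cong (Q *_) (fromℤ-* q qᵐ))) ⟩
    (t * s₂ - s₁) * (Q * (Q * fromℤ qᵐ))       ≡⟨ solve 5 (λ t s₂ s₁ Q x → (t :* s₂ :- s₁) :* (Q :* (Q :* x)) := (t :* Q) :* (s₂ :* (Q :* x)) :- Q :* (Q :* (s₁ :* x))) refl t s₂ s₁ Q (fromℤ qᵐ) ⟩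
    (t * Q) * (s₂ * (Q * fromℤ qᵐ)) - Q * (Q * (s₁ * fromℤ qᵐ))
      ≡⟨ cong₂ (λ x y → x * y - Q * (Q * (s₁ * fromℤ qᵐ))) tq≡p (trans (cong (s₂ *_) (sym (fromℤ-* q qᵐ))) (chebyshev-scaled t tq≡p (suc m))) ⟩
    P * fromℤ (scaled (suc (suc m))) - Q * (Q * (s₁ * fromℤ qᵐ))
      ≡⟨ cong (λ x → P * fromℤ (scaled (suc (suc m))) - Q * (Q * x)) (chebyshev-scaled t tq≡p m) ⟩
    P * fromℤ (scaled (suc (suc m))) - Q * (Q * fromℤ (scaled (suc m)))
      ≡⟨ sym (fromℤ-scaled-step _ _) ⟩
    fromℤ (scaled (suc (suc (suc m))))         ∎
    where open ≡-Reasoning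
          open ℚ-Solver.+-*-Solver
          P = fromℤ p
          Q = fromℤ q
          qᵐ = q ℤ.^ m
          s₂ = chebyshev t (suc (suc m))
          s₁ = chebyshev t (suc m)

∣i^n∣≡∣i∣^n : ∀ i n → ℤ.∣ i ℤ.^ n ∣ ≡ ℤ.∣ i ∣ ℕ.^ n
∣i^n∣≡∣i∣^n i zero    = refl
∣i^n∣≡∣i∣^n i (suc n) = trans (ℤ.∣i*j∣≡∣i∣*∣j∣ i (i ℤ.^ n)) (cong (ℤ.∣ i ∣ ℕ.*_) (∣i^n∣≡∣i∣^n i n))

coprime-∣^⇒∣1 : ∀ {a b} → Coprime a b → ∀ n → a ∣ b ℕ.^ n → a ∣ 1
coprime-∣^⇒∣1 a⊥b zero    a∣bⁿ = a∣bⁿ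
coprime-∣^⇒∣1 a⊥b (suc n) a∣bⁿ = coprime-∣^⇒∣1 a⊥b n (coprime-divisor a⊥b a∣bⁿ)

chebyshev-nonvanishing : ∀ t → ℚ.denominator-1 t ≢ 0 → ∀ m → chebyshev t (suc m) ≢ 0ℚ
chebyshev-nonvanishing t@(mkℚ p d p⊥q) d≢0 m sₘ₊₁≡0 = d≢0 (ℕ.suc-injective q≡1)
  where
  open ScaledChebyshev p (↧ t)
  scaled≡0 : scaled (suc m) ≡ + 0
  scaled≡0 = fromℤ-injective (begin
    fromℤ (scaled (suc m))                        ≡⟨ chebyshev-scaled t (*-denominator t) m ⟨
    chebyshev t (suc m) * fromℤ (↧ t ℤ.^ m)       ≡⟨ cong (_* fromℤ (↧ t ℤ.^ m)) sₘ₊₁≡0 ⟩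
    0ℚ * fromℤ (↧ t ℤ.^ m)                        ≡⟨ ℚ.*-zeroˡ (fromℤ (↧ t ℤ.^ m)) ⟩
    0ℚ                                            ∎)
    where open ≡-Reasoning
  q∣-pᵐ : ↧ t ℤ.∣ ℤ.- (p ℤ.^ m)
  q∣-pᵐ = subst (↧ t ℤ.∣_) (trans (cong (ℤ._- p ℤ.^ m) scaled≡0) (ℤ.+-identityˡ _)) (scaled≡pow-mod m)
  q≡1 : suc d ≡ 1
  q≡1 = ∣1⇒≡1 (coprime-∣^⇒∣1 (Coprimality.sym (Coprimality.recompute p⊥q)) m
                   (subst (suc d ∣_) (trans (ℤ.∣-i∣≡∣i∣ (p ℤ.^ m)) (∣i^n∣≡∣i∣^n p m)) (ℤ.∣⇒∣ᵤ q∣-pᵐ)))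

-- Grover walks on finite graphs

fromℕ-length-filterᵇ : ∀ {A : Set} (p : A → Bool) (xs : List A) →
                       fromℕ (length (filterᵇ p xs)) ≡ ∑[ x ∈ xs ] (if p x then 1ℚ else 0ℚ)
fromℕ-length-filterᵇ p []       = refl
fromℕ-length-filterᵇ p (x ∷ xs) with p x
... | true  = cong (λ y → 1ℚ + y) (fromℕ-length-filterᵇ p xs)
... | false = trans (fromℕ-length-filterᵇ p xs) (sym (ℚ.+-identityˡ _))

twoOver : ℕ → ℚ
twoOver zero    = 0ℚ
twoOver (suc d) = + 2 / suc d

twoOverDeg≡twoOver-deg : ∀ G u → twoOverDeg G u ≡ twoOver (deg G u)
twoOverDeg≡twoOver-deg G u with deg G u
... | zero  = refl
... | suc d = refl

twoOver-*-fromℕ : ∀ d → d ≢ 0 → twoOver d * fromℕ d ≡ 1ℚ + 1ℚ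
twoOver-*-fromℕ zero    d≢0 = ⊥-elim (d≢0 refl)
twoOver-*-fromℕ (suc d) _   = trans (cong (twoOver (suc d) *_) (fromℕ≡fromℤ (suc d))) (/-*-denominator (+ 2) d)

module Walk (G : FinGraph) where
  open FinGraph G

  U^ : ℕ → Matrix G
  U^ m = _^_ G (U G) m

  Vector : Set
  Vector = Arc G → ℚ

  infixr 20 _·_
  _·_ : Matrix G → Vector → Vector
  (A · h) e = ∑[ f ∈ arcs G ] (A e f * h f)

  ⊗-· : ∀ A B h e → (_⊗_ G A B · h) e ≡ (A · B · h) e
  ⊗-· A B h e = begin
    ∑[ g ∈ arcs G ] (∑[ f ∈ arcs G ] (A e f * B f g) * h g)     ≡⟨ ∑-cong′ (arcs G) (λ g → sym (∑-*ʳ (arcs G) (h g) (λ f → A e f * B f g))) ⟩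
    ∑[ g ∈ arcs G ] ∑[ f ∈ arcs G ] (A e f * B f g * h g)       ≡⟨ ∑-comm (arcs G) (arcs G) (λ g f → A e f * B f g * h g) ⟩
    ∑[ f ∈ arcs G ] ∑[ g ∈ arcs G ] (A e f * B f g * h g)       ≡⟨ ∑-cong′ (arcs G) (λ f → trans (∑-cong′ (arcs G) (λ g → ℚ.*-assoc (A e f) (B f g) (h g)))
                                                                                            (∑-*ˡ (arcs G) (A e f) (λ g → B f g * h g))) ⟩
    ∑[ f ∈ arcs G ] (A e f * ∑[ g ∈ arcs G ] (B f g * h g))     ∎
    where open ≡-Reasoning

  ·-cong : ∀ A {h h′ : Vector} → (∀ f → f ∈ arcs G → h f ≡ h′ f) → ∀ e → (A · h) e ≡ (A · h′) e
  ·-cong A h≡h′ e = ∑-cong (arcs G) (λ f f∈ → cong (A e f *_) (h≡h′ f f∈))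

  ·-linear : ∀ A a b (h h′ : Vector) e → (A · (λ f → a * h f + b * h′ f)) e ≡ a * (A · h) e + b * (A · h′) e
  ·-linear A a b h h′ e =
    trans (∑-cong′ (arcs G) (λ f → solve 5 (λ x a b y z → x :* (a :* y :+ b :* z) := a :* (x :* y) :+ b :* (x :* z)) refl (A e f) a b (h f) (h′ f)))
          (trans (∑-+ (arcs G) _ _) (cong₂ _+_ (∑-*ˡ (arcs G) a _) (∑-*ˡ (arcs G) b _)))
    where open ℚ-Solver.+-*-Solver

  I-· : Unique (arcs G) → ∀ h e → e ∈ arcs G → (I G · h) e ≡ h e
  I-· arcs! h e e∈ = trans (∑-cong′ (arcs G) δ) (∑-select (_≟A_ G) (arcs G) arcs! e∈ h)
    where
    δ : ∀ f → (if ⌊ _≟A_ G e f ⌋ then 1ℚ else 0ℚ) * h f ≡ (if ⌊ _≟A_ G f e ⌋ then h f else 0ℚ)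
    δ f with _≟A_ G e f | _≟A_ G f e
    ... | yes _   | yes _   = ℚ.*-identityˡ (h f)
    ... | no _    | no _    = ℚ.*-zeroˡ (h f)
    ... | yes e≡f | no f≢e  = ⊥-elim (f≢e (sym e≡f))
    ... | no e≢f  | yes f≡e = ⊥-elim (e≢f (sym f≡e))

  neighbourSum : V → (V → ℚ) → ℚ
  neighbourSum u F = ∑[ w ∈ verts ] (if adj w u then F w else 0ℚ)

  U-· : Unique verts → ∀ u v → u ∈ verts → v ∈ verts → adj v u ≡ true → (h : Vector) →
        (U G · h) (u , v) ≡ twoOverDeg G u * neighbourSum u (λ w → h (w , u)) - h (v , u)
  U-· verts! u v u∈ v∈ v~u h = begin
    (U G · h) (u , v)
      ≡⟨ ∑-filterᵇ _ (cartesianProduct verts verts) (λ f → U G (u , v) f * h f) ⟩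
    ∑[ f ∈ cartesianProduct verts verts ] (if adj (proj₁ f) (proj₂ f) then U G (u , v) f * h f else 0ℚ)
      ≡⟨ ∑-cartesianProduct verts verts _ ⟩
    ∑[ w ∈ verts ] ∑[ x ∈ verts ] (if adj w x then U G (u , v) (w , x) * h (w , x) else 0ℚ)
      ≡⟨ ∑-cong′ verts (λ w → trans (∑-cong′ verts (into-u w)) (∑-select _≟V_ verts verts! u∈ (entering w))) ⟩
    ∑[ w ∈ verts ] entering w u
      ≡⟨ ∑-cong′ verts split ⟩
    ∑[ w ∈ verts ] (tod u * (if adj w u then h (w , u) else 0ℚ) + - (if ⌊ w ≟V v ⌋ then h (w , u) else 0ℚ))
      ≡⟨ ∑-+ verts _ _ ⟩
    ∑[ w ∈ verts ] (tod u * (if adj w u then h (w , u) else 0ℚ)) + ∑[ w ∈ verts ] (- (if ⌊ w ≟V v ⌋ then h (w , u) else 0ℚ))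
      ≡⟨ cong₂ _+_ (∑-*ˡ verts (tod u) _) (trans (∑-neg verts _) (cong -_ (∑-select _≟V_ verts verts! v∈ (λ w → h (w , u))))) ⟩
    tod u * neighbourSum u (λ w → h (w , u)) - h (v , u)
      ∎
    where
    open ≡-Reasoning
    tod = twoOverDeg G
    entering : V → V → ℚ
    entering w x = if adj w x then (if ⌊ _≟A_ G (u , v) (x , w) ⌋ then tod x - 1ℚ else tod x) * h (w , x) else 0ℚ
    into-u : ∀ w x → (if adj w x then U G (u , v) (w , x) * h (w , x) else 0ℚ) ≡ (if ⌊ x ≟V u ⌋ then entering w x else 0ℚ)
    into-u w x with x ≟V u
    ... | yes _ = refl
    ... | no _ with adj w x
    ...   | true  = ℚ.*-zeroˡ (h (w , x))
    ...   | false = refl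
    split : ∀ w → entering w u ≡ tod u * (if adj w u then h (w , u) else 0ℚ) + - (if ⌊ w ≟V v ⌋ then h (w , u) else 0ℚ)
    split w with _≟A_ G (u , v) (u , w) | w ≟V v
    ... | yes _     | yes refl rewrite v~u = solve 2 (λ a b → (a :- con 1ℚ) :* b := a :* b :+ :- b) refl (tod u) (h (w , u))
      where open ℚ-Solver.+-*-Solver
    ... | yes uv≡uw | no w≢v  = ⊥-elim (w≢v (sym (cong proj₂ uv≡uw)))
    ... | no uv≢uw  | yes refl = ⊥-elim (uv≢uw refl)
    ... | no _      | no _ with adj w u
    ...   | true  = sym (ℚ.+-identityʳ _)
    ...   | false = sym (trans (ℚ.+-identityʳ _) (ℚ.*-zeroʳ (tod u)))

module SimpleGraph (G : FinGraph) (verts! : Unique (FinGraph.verts G))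
                   (adj-sym : ∀ x y → FinGraph.adj G x y ≡ FinGraph.adj G y x) where
  open FinGraph G
  open Walk G

  ∈-arcs⁻ : ∀ {u v} → (u , v) ∈ arcs G → u ∈ verts × v ∈ verts × adj u v ≡ true
  ∈-arcs⁻ uv∈ with ∈-filter⁻ (λ e → T? (adj (proj₁ e) (proj₂ e))) {xs = cartesianProduct verts verts} uv∈
  ... | uv∈V² , u~v with ∈-cartesianProductWith⁻ _,_ verts verts uv∈V²
  ...   | _ , _ , u∈ , v∈ , refl = u∈ , v∈ , Equivalence.to Bool.T-≡ u~v

  ∈-arcs⁺ : ∀ {u v} → u ∈ verts → v ∈ verts → adj u v ≡ true → (u , v) ∈ arcs G
  ∈-arcs⁺ u∈ v∈ u~v = ∈-filter⁺ (λ e → T? (adj (proj₁ e) (proj₂ e))) (∈-cartesianProductWith⁺ _,_ u∈ v∈) (Equivalence.from Bool.T-≡ u~v)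

  arcs! : Unique (arcs G)
  arcs! = Unique.filter⁺ (λ e → T? (adj (proj₁ e) (proj₂ e))) (Unique.cartesianProduct⁺ verts! verts!)

  neighbourSum-const : ∀ u c → neighbourSum u (λ _ → c) ≡ c * fromℕ (deg G u)
  neighbourSum-const u c = begin
    neighbourSum u (λ _ → c)                          ≡⟨ ∑-if-const verts (λ w → adj w u) c ⟩
    c * ∑[ w ∈ verts ] (if adj w u then 1ℚ else 0ℚ)   ≡⟨ cong (c *_) (∑-cong′ verts (λ w → cong (if_then 1ℚ else 0ℚ) (adj-sym w u))) ⟩
    c * ∑[ w ∈ verts ] (if adj u w then 1ℚ else 0ℚ)   ≡⟨ cong (c *_) (fromℕ-length-filterᵇ (adj u) verts) ⟨
    c * fromℕ (deg G u)                               ∎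
    where open ≡-Reasoning

  twoOverDeg-neighbourSum-const : ∀ u → deg G u ≢ 0 → ∀ c → twoOverDeg G u * neighbourSum u (λ _ → c) ≡ c + c
  twoOverDeg-neighbourSum-const u deg≢0 c = begin
    twoOverDeg G u * neighbourSum u (λ _ → c)       ≡⟨ cong₂ _*_ (twoOverDeg≡twoOver-deg G u) (neighbourSum-const u c) ⟩
    twoOver (deg G u) * (c * fromℕ (deg G u))       ≡⟨ solve 3 (λ τ c D → τ :* (c :* D) := c :* (τ :* D)) refl (twoOver (deg G u)) c (fromℕ (deg G u)) ⟩
    c * (twoOver (deg G u) * fromℕ (deg G u))       ≡⟨ cong (c *_) (twoOver-*-fromℕ (deg G u) deg≢0) ⟩
    c * (1ℚ + 1ℚ)                                   ≡⟨ solve 1 (λ c → c :* (con 1ℚ :+ con 1ℚ) := c :+ c) refl c ⟩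
    c + c                                           ∎
    where open ≡-Reasoning
          open ℚ-Solver.+-*-Solver

  ArcWithEqualEnds ArcWithDistinctEnds : (V → ℚ) → Set
  ArcWithEqualEnds    φ = ∃[ e ] e ∈ arcs G × φ (o G e) ≡ φ (t G e) × φ (o G e) ≢ 0ℚ
  ArcWithDistinctEnds φ = ∃[ e ] e ∈ arcs G × φ (o G e) ≢ φ (t G e)

  module EigenfunctionLift (φ : V → ℚ) (μ : ℚ)
           (deg≢0 : ∀ u → u ∈ verts → deg G u ≢ 0)
           (eigen : ∀ u → u ∈ verts → twoOverDeg G u * neighbourSum u φ ≡ μ * φ u) where

    φₒ φₜ : Vector
    φₒ e = φ (o G e)
    φₜ e = φ (t G e)

    U-φₒ : ∀ e → e ∈ arcs G → (U G · φₒ) e ≡ μ * φₒ e - φₜ e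
    U-φₒ (u , v) uv∈ with ∈-arcs⁻ uv∈
    ... | u∈ , v∈ , u~v =
      trans (U-· verts! u v u∈ v∈ (trans (adj-sym v u) u~v) φₒ) (cong (_- φ v) (eigen u u∈))

    U-φₜ : ∀ e → e ∈ arcs G → (U G · φₜ) e ≡ φₒ e
    U-φₜ (u , v) uv∈ with ∈-arcs⁻ uv∈
    ... | u∈ , v∈ , u~v =
      trans (U-· verts! u v u∈ v∈ (trans (adj-sym v u) u~v) φₜ)
            (trans (cong (_- φ u) (twoOverDeg-neighbourSum-const u (deg≢0 u u∈) (φ u)))
                   (solve 1 (λ x → (x :+ x) :- x := x) refl (φ u)))
      where open ℚ-Solver.+-*-Solver

    U^-φₒ : ∀ m e → e ∈ arcs G → (U^ m · φₒ) e ≡ chebyshev μ (suc m) * φₒ e - chebyshev μ m * φₜ e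
    U^-φₒ zero    e e∈ = trans (I-· arcs! φₒ e e∈) (solve 2 (λ a b → a := con 1ℚ :* a :- con 0ℚ :* b) refl (φₒ e) (φₜ e))
      where open ℚ-Solver.+-*-Solver
    U^-φₒ (suc m) e e∈ = begin
      (U^ (suc m) · φₒ) e
        ≡⟨ ⊗-· (U G) (U^ m) φₒ e ⟩
      (U G · U^ m · φₒ) e
        ≡⟨ ·-cong (U G) (λ f f∈ → trans (U^-φₒ m f f∈) (cong (λ x → sₘ₊₁ * φₒ f + x) (ℚ.neg-distribˡ-* sₘ (φₜ f)))) e ⟩
      (U G · (λ f → sₘ₊₁ * φₒ f + - sₘ * φₜ f)) e
        ≡⟨ ·-linear (U G) sₘ₊₁ (- sₘ) φₒ φₜ e ⟩
      sₘ₊₁ * (U G · φₒ) e + - sₘ * (U G · φₜ) e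
        ≡⟨ cong₂ (λ x y → sₘ₊₁ * x + - sₘ * y) (U-φₒ e e∈) (U-φₜ e e∈) ⟩
      sₘ₊₁ * (μ * φₒ e - φₜ e) + - sₘ * φₒ e
        ≡⟨ solve 5 (λ a b t x y → a :* (t :* x :- y) :+ :- b :* x := (t :* a :- b) :* x :- a :* y) refl sₘ₊₁ sₘ μ (φₒ e) (φₜ e) ⟩
      chebyshev μ (suc (suc m)) * φₒ e - sₘ₊₁ * φₜ e
        ∎
      where open ≡-Reasoning
            open ℚ-Solver.+-*-Solver
            sₘ₊₁ = chebyshev μ (suc m)
            sₘ = chebyshev μ m

    -- Uᵐ⁺¹ = I applied to φₒ gives sₘ₊₂ = sₘ₊₁ + 1 at e₁, and then sₘ₊₁ = 0 at e₂.
    periodic⇒chebyshev-root : Periodic G → ArcWithEqualEnds φ → ArcWithDistinctEnds φ → ∃[ m ] chebyshev μ (suc m) ≡ 0ℚ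
    periodic⇒chebyshev-root (suc m , _ , Uᵐ≡I) (e₁ , e₁∈ , φe₁ , φe₁≢0) (e₂ , e₂∈ , φe₂) = m , sₘ₊₁≡0
      where
      open ≡-Reasoning
      open ℚ-Solver.+-*-Solver
      sₘ₊₂ = chebyshev μ (suc (suc m))
      sₘ₊₁ = chebyshev μ (suc m)
      fixed : ∀ e → e ∈ arcs G → sₘ₊₂ * φₒ e - sₘ₊₁ * φₜ e ≡ φₒ e
      fixed e e∈ = begin
        sₘ₊₂ * φₒ e - sₘ₊₁ * φₜ e   ≡⟨ U^-φₒ (suc m) e e∈ ⟨
        (U^ (suc m) · φₒ) e         ≡⟨ ∑-cong (arcs G) (λ f f∈ → cong (_* φₒ f) (Uᵐ≡I e f e∈ f∈)) ⟩
        (I G · φₒ) e                ≡⟨ I-· arcs! φₒ e e∈ ⟩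
        φₒ e                        ∎
      x = φₒ e₁
      sₘ₊₂≡sₘ₊₁+1 : sₘ₊₂ ≡ sₘ₊₁ + 1ℚ
      sₘ₊₂≡sₘ₊₁+1 = x∙y⁻¹≈ε⇒x≈y sₘ₊₂ (sₘ₊₁ + 1ℚ) (x≢0∧x*y≡0⇒y≡0 x _ φe₁≢0 (begin
        x * (sₘ₊₂ - (sₘ₊₁ + 1ℚ))        ≡⟨ solve 3 (λ x a b → x :* (a :- (b :+ con 1ℚ)) := (a :* x :- b :* x) :- x) refl x sₘ₊₂ sₘ₊₁ ⟩
        (sₘ₊₂ * x - sₘ₊₁ * x) - x       ≡⟨ cong (λ y → (sₘ₊₂ * x - sₘ₊₁ * y) - x) φe₁ ⟩
        (sₘ₊₂ * x - sₘ₊₁ * φₜ e₁) - x   ≡⟨ cong (_- x) (fixed e₁ e₁∈) ⟩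
        x - x                           ≡⟨ ℚ.+-inverseʳ x ⟩
        0ℚ                              ∎))
      p = φₒ e₂
      q = φₜ e₂
      sₘ₊₁≡0 : sₘ₊₁ ≡ 0ℚ
      sₘ₊₁≡0 = x≢0∧x*y≡0⇒y≡0 (p - q) sₘ₊₁ (λ p-q≡0 → φe₂ (x∙y⁻¹≈ε⇒x≈y p q p-q≡0)) (begin
        (p - q) * sₘ₊₁
          ≡⟨ solve 4 (λ p q a b → (p :- q) :* b := (a :* p :- b :* q) :- p :+ (b :+ con 1ℚ :- a) :* p) refl p q sₘ₊₂ sₘ₊₁ ⟩
        (sₘ₊₂ * p - sₘ₊₁ * q) - p + (sₘ₊₁ + 1ℚ - sₘ₊₂) * p
          ≡⟨ cong₂ (λ y z → y - p + (z - sₘ₊₂) * p) (fixed e₂ e₂∈) (sym sₘ₊₂≡sₘ₊₁+1) ⟩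
        p - p + (sₘ₊₂ - sₘ₊₂) * p
          ≡⟨ solve 2 (λ p a → p :- p :+ (a :- a) :* p := con 0ℚ) refl p sₘ₊₂ ⟩
        0ℚ
          ∎)

    non-integral⇒¬periodic : ℚ.denominator-1 μ ≢ 0 → ArcWithEqualEnds φ → ArcWithDistinctEnds φ → ¬ Periodic G
    non-integral⇒¬periodic μ∉ℤ equal distinct periodic =
      chebyshev-nonvanishing μ μ∉ℤ (proj₁ root) (proj₂ root)
      where root = periodic⇒chebyshev-root periodic equal distinct

-- Powers of U are evaluated column by column, each column tabulated along the arc list and
-- computed from the previous one, with 2/deg replaced by the constant τ to avoid recounting degrees.
module RegularPowers (G : FinGraph) (verts! : Unique (FinGraph.verts G))
                     (adj-sym : ∀ x y → FinGraph.adj G x y ≡ FinGraph.adj G y x)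
                     (τ : ℚ) (twoOverDeg≡τ : ∀ v → v ∈ FinGraph.verts G → twoOverDeg G v ≡ τ) where
  open FinGraph G
  open Walk G
  open SimpleGraph G verts! adj-sym

  Uτ : Matrix G
  Uτ e f = if ⌊ t G f ≟V o G e ⌋ then (if ⌊ _≟A_ G e (_⁻¹ G f) ⌋ then τ - 1ℚ else τ) else 0ℚ

  U≡Uτ : ∀ e f → f ∈ arcs G → U G e f ≡ Uτ e f
  U≡Uτ e (v , w) vw∈ rewrite twoOverDeg≡τ w (proj₁ (proj₂ (∈-arcs⁻ vw∈))) = refl

  Table : Set
  Table = List (Arc G × ℚ)

  tabulate : (Arc G → ℚ) → Table
  tabulate F = map (λ g → g , F g) (arcs G)

  Uτ-table : Table → Table
  Uτ-table w = map (λ e → e , ∑[ gx ∈ w ] (Uτ e (proj₁ gx) * proj₂ gx)) (arcs G)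

  power-column : Arc G → ℕ → Table
  power-column f zero    = tabulate (λ e → I G e f)
  power-column f (suc m) = Uτ-table (power-column f m)

  power-column-correct : ∀ m f → ∃[ F ] power-column f m ≡ tabulate F × (∀ g → g ∈ arcs G → U^ m g f ≡ F g)
  power-column-correct zero    f = (λ e → I G e f) , refl , (λ _ _ → refl)
  power-column-correct (suc m) f with power-column-correct m f
  ... | F , column≡F , Uᵐ≡F =
    (λ e → ∑[ g ∈ arcs G ] (Uτ e g * F g)) ,
    trans (cong Uτ-table column≡F) (map-cong (λ e → cong (e ,_) (∑-map (λ g → g , F g) (arcs G) _)) (arcs G)) ,
    λ e e∈ → ∑-cong (arcs G) (λ g g∈ → cong₂ _*_ (U≡Uτ e g g∈) (Uᵐ≡F g g∈))

  power-is-identity? : ∀ m → Dec (All (λ f → All (λ gx → proj₂ gx ≡ I G (proj₁ gx) f) (power-column f m)) (arcs G))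
  power-is-identity? m = All.all? (λ f → All.all? (λ gx → proj₂ gx ℚ.≟ I G (proj₁ gx) f) (power-column f m)) (arcs G)

  periodic-by-computation : ∀ m → 1 ≤ m → True (power-is-identity? m) → Periodic G
  periodic-by-computation m 1≤m check = m , 1≤m , Uᵐ≡I
    where
    Uᵐ≡I : ∀ e f → e ∈ arcs G → f ∈ arcs G → U^ m e f ≡ I G e f
    Uᵐ≡I e f e∈ f∈ with power-column-correct m f
    ... | F , column≡F , Uᵐ≡F =
      trans (Uᵐ≡F e e∈) (All.lookup (subst (All _) column≡F (All.lookup (toWitness check) f∈)) (∈-map⁺ (λ g → g , F g) e∈))

-- Counting subsets of a finite set

count : (n : ℕ) → (Subset n → Bool) → ℚ
count n p = ∑[ w ∈ allSubsets n ] (if p w then 1ℚ else 0ℚ)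

count-suc : ∀ n p → count (suc n) p ≡ count n (λ w → p (false ∷ w)) + count n (λ w → p (true ∷ w))
count-suc n p = trans (∑-++ (map (false ∷_) (allSubsets n)) (map (true ∷_) (allSubsets n)) _)
                      (cong₂ _+_ (∑-map (false ∷_) (allSubsets n) _) (∑-map (true ∷_) (allSubsets n) _))

count-cong : ∀ n {p q : Subset n → Bool} → (∀ w → p w ≡ q w) → count n p ≡ count n q
count-cong n p≗q = ∑-cong′ (allSubsets n) (λ w → cong (if_then 1ℚ else 0ℚ) (p≗q w))

count-none : ∀ n {p : Subset n → Bool} → (∀ w → p w ≡ false) → count n p ≡ 0ℚ
count-none n p≗false = trans (count-cong n p≗false) (∑-zero (allSubsets n))

module _ {n : ℕ} (u : Subset n) where

  sameᵇ extendsᵇ shrinksᵇ neighbourᵇ : Subset n → Bool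
  sameᵇ      w = (∣ w ∣ ≡ᵇ ∣ u ∣)     ∧ (∣ u ∩ w ∣ ≡ᵇ ∣ u ∣)
  extendsᵇ   w = (∣ w ∣ ≡ᵇ suc ∣ u ∣) ∧ (∣ u ∩ w ∣ ≡ᵇ ∣ u ∣)
  shrinksᵇ   w = (suc ∣ w ∣ ≡ᵇ ∣ u ∣) ∧ (suc ∣ u ∩ w ∣ ≡ᵇ ∣ u ∣)
  neighbourᵇ w = (∣ w ∣ ≡ᵇ ∣ u ∣)     ∧ (suc ∣ u ∩ w ∣ ≡ᵇ ∣ u ∣)

∣p∩q∣≤∣p∣ : ∀ {n} (p q : Subset n) → ∣ p ∩ q ∣ ≤ ∣ p ∣
∣p∩q∣≤∣p∣ p q = Subset.p⊆q⇒∣p∣≤∣q∣ (Subset.p∩q⊆p p q)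

∣p∩q∣≤∣q∣ : ∀ {n} (p q : Subset n) → ∣ p ∩ q ∣ ≤ ∣ q ∣
∣p∩q∣≤∣q∣ p q = Subset.p⊆q⇒∣p∣≤∣q∣ (Subset.p∩q⊆q p q)

∣p∩p∣≡∣p∣ : ∀ {n} (p : Subset n) → ∣ p ∩ p ∣ ≡ ∣ p ∣
∣p∩p∣≡∣p∣ p = cong ∣_∣ (Subset.∩-idem p)

private
  ≢ᵇ : ∀ {x y} → x ≢ y → (x ≡ᵇ y) ≡ false
  ≢ᵇ {x} {y} = dec-false (x ℕ.≟ y)

  ∧-≢ᵇ : ∀ a {x y} → x ≢ y → (a ∧ (x ≡ᵇ y)) ≡ false
  ∧-≢ᵇ a x≢y rewrite ≢ᵇ x≢y = Bool.∧-zeroʳ a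

  ≢ᵇ-∧ : ∀ {x y} z → x ≢ y → ((x ≡ᵇ z) ∧ (y ≡ᵇ z)) ≡ false
  ≢ᵇ-∧ {x} {y} z x≢y with x ℕ.≟ z
  ... | no x≢z  rewrite ≢ᵇ x≢z = refl
  ... | yes refl rewrite ≢ᵇ (≢-sym x≢y) = Bool.∧-zeroʳ (x ≡ᵇ x)

count-same : ∀ n (u : Subset n) → count n (sameᵇ u) ≡ 1ℚ
count-same zero    []        = refl
count-same (suc n) (true ∷ u) =
  trans (count-suc n _)
        (trans (cong₂ _+_ (count-none n (λ w → ∧-≢ᵇ _ (ℕ.<⇒≢ (s≤s (∣p∩q∣≤∣p∣ u w))))) (count-same n u))
               (ℚ.+-identityˡ 1ℚ))
count-same (suc n) (false ∷ u) =
  trans (count-suc n _)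
        (trans (cong₂ _+_ (count-same n u) (count-none n (λ w → ≢ᵇ-∧ ∣ u ∣ (ℕ.>⇒≢ (s≤s (∣p∩q∣≤∣q∣ u w))))))
               (ℚ.+-identityʳ 1ℚ))

count-extends : ∀ n (u : Subset n) → count n (extendsᵇ u) ≡ fromℕ n - fromℕ ∣ u ∣
count-extends zero    []         = refl
count-extends (suc n) (true ∷ u)  =
  trans (count-suc n _)
        (trans (cong₂ _+_ (count-none n (λ w → ∧-≢ᵇ _ (ℕ.<⇒≢ (s≤s (∣p∩q∣≤∣p∣ u w))))) (count-extends n u))
               (solve 2 (λ x a → con 0ℚ :+ (x :- a) := (con 1ℚ :+ x) :- (con 1ℚ :+ a)) refl (fromℕ n) (fromℕ ∣ u ∣)))
  where open ℚ-Solver.+-*-Solver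
count-extends (suc n) (false ∷ u) =
  trans (count-suc n _)
        (trans (cong₂ _+_ (count-extends n u) (count-same n u))
               (solve 2 (λ x a → (x :- a) :+ con 1ℚ := (con 1ℚ :+ x) :- a) refl (fromℕ n) (fromℕ ∣ u ∣)))
  where open ℚ-Solver.+-*-Solver

count-shrinks : ∀ n (u : Subset n) → count n (shrinksᵇ u) ≡ fromℕ ∣ u ∣
count-shrinks zero    []          = refl
count-shrinks (suc n) (true ∷ u)  = trans (count-suc n _) (cong₂ _+_ (count-same n u) (count-shrinks n u))
count-shrinks (suc n) (false ∷ u) =
  trans (count-suc n _)
        (trans (cong₂ _+_ (count-shrinks n u) (count-none n (λ w → ≢ᵇ-∧ ∣ u ∣ (ℕ.>⇒≢ (s≤s (s≤s (∣p∩q∣≤∣q∣ u w)))))))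
               (ℚ.+-identityʳ _))

count-neighbours : ∀ n (u : Subset n) → count n (neighbourᵇ u) ≡ fromℕ ∣ u ∣ * (fromℕ n - fromℕ ∣ u ∣)
count-neighbours zero    []          = refl
count-neighbours (suc n) (true ∷ u)  =
  trans (count-suc n _)
        (trans (cong₂ _+_ (count-extends n u) (count-neighbours n u))
               (solve 2 (λ x a → (x :- a) :+ a :* (x :- a) := (con 1ℚ :+ a) :* ((con 1ℚ :+ x) :- (con 1ℚ :+ a))) refl (fromℕ n) (fromℕ ∣ u ∣)))
  where open ℚ-Solver.+-*-Solver
count-neighbours (suc n) (false ∷ u) =
  trans (count-suc n _)
        (trans (cong₂ _+_ (count-neighbours n u) (count-shrinks n u))
               (solve 2 (λ x a → a :* (x :- a) :+ a := a :* ((con 1ℚ :+ x) :- a)) refl (fromℕ n) (fromℕ ∣ u ∣)))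
  where open ℚ-Solver.+-*-Solver

count-neighbours-∋0 : ∀ n (u : Subset (suc n)) → count (suc n) (λ w → neighbourᵇ u w ∧ head w) ≡
  (if head u then fromℕ (ℕ.pred ∣ u ∣) * (fromℕ n - fromℕ (ℕ.pred ∣ u ∣)) else fromℕ ∣ u ∣)
count-neighbours-∋0 n (true ∷ u)  =
  trans (count-suc n _)
        (trans (cong₂ _+_ (count-none n (λ w → Bool.∧-zeroʳ _))
                          (trans (count-cong n (λ w → Bool.∧-identityʳ _)) (count-neighbours n u)))
               (ℚ.+-identityˡ _))
count-neighbours-∋0 n (false ∷ u) =
  trans (count-suc n _)
        (trans (cong₂ _+_ (count-none n (λ w → Bool.∧-zeroʳ _))
                          (trans (count-cong n (λ w → Bool.∧-identityʳ _)) (count-shrinks n u)))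
               (ℚ.+-identityˡ _))

-- Johnson graphs

allSubsets-unique : ∀ n → Unique (allSubsets n)
allSubsets-unique zero    = [] ∷ []
allSubsets-unique (suc n) =
  Unique.++⁺ (Unique.map⁺ Vec.∷-injectiveʳ (allSubsets-unique n)) (Unique.map⁺ Vec.∷-injectiveʳ (allSubsets-unique n)) disjoint
  where
  disjoint : ∀ {v} → ¬ (v ∈ map (false ∷_) (allSubsets n) × v ∈ map (true ∷_) (allSubsets n))
  disjoint (v∈₀ , v∈₁) with ∈-map⁻ (false ∷_) v∈₀ | ∈-map⁻ (true ∷_) v∈₁
  ... | _ , _ , refl | _ , _ , ()

∈-allSubsets : ∀ {n} (x : Subset n) → x ∈ allSubsets n
∈-allSubsets []                  = here refl
∈-allSubsets (false ∷ x)         = ∈-++⁺ˡ (∈-map⁺ (false ∷_) (∈-allSubsets x))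
∈-allSubsets {suc n} (true ∷ x)  = ∈-++⁺ʳ (map (false ∷_) (allSubsets n)) (∈-map⁺ (true ∷_) (∈-allSubsets x))

⌊≟⌋-sym : ∀ {A : Set} (_≟_ : DecidableEquality A) x y → ⌊ x ≟ y ⌋ ≡ ⌊ y ≟ x ⌋
⌊≟⌋-sym _≟_ x y with x ≟ y | y ≟ x
... | yes _   | yes _   = refl
... | no _    | no _    = refl
... | yes x≡y | no y≢x  = ⊥-elim (y≢x (sym x≡y))
... | no x≢y  | yes y≡x = ⊥-elim (x≢y (sym y≡x))

x*1-y≡x*0-y⇒x≡0 : ∀ x y → x * 1ℚ - y ≡ x * 0ℚ - y → x ≡ 0ℚ
x*1-y≡x*0-y⇒x≡0 x y eq = begin
  x                      ≡⟨ solve 2 (λ x y → x := (x :* con 1ℚ :- y) :+ y) refl x y ⟩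
  (x * 1ℚ - y) + y       ≡⟨ cong (_+ y) eq ⟩
  (x * 0ℚ - y) + y       ≡⟨ solve 2 (λ x y → (x :* con 0ℚ :- y) :+ y := con 0ℚ) refl x y ⟩
  0ℚ                     ∎
  where open ≡-Reasoning
        open ℚ-Solver.+-*-Solver

x*0-y≡0⇒y≡0 : ∀ x y → x * 0ℚ - y ≡ 0ℚ → y ≡ 0ℚ
x*0-y≡0⇒y≡0 x y eq = sym (x∙y⁻¹≈ε⇒x≈y 0ℚ y (trans (cong (_- y) (sym (ℚ.*-zeroʳ x))) eq))

x*1-y≡0⇒x≡y : ∀ x y → x * 1ℚ - y ≡ 0ℚ → x ≡ y
x*1-y≡0⇒x≡y x y eq = x∙y⁻¹≈ε⇒x≈y x y (trans (cong (_- y) (sym (ℚ.*-identityʳ x))) eq)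

χ : Bool → ℚ
χ true  = 1ℚ
χ false = 0ℚ

-- J(n′ + 1, k′ + 1): the shift gives every subset a head (the point 0) and makes k ∸ 1 reduce to k′.
module JohnsonGraph (n′ k′ : ℕ) where
  n k : ℕ
  n = suc n′
  k = suc k′

  G : FinGraph
  G = Johnson n k
  open FinGraph G
  open Walk G public

  size≟k : Subset n → Bool
  size≟k x = ⌊ ∣ x ∣ ℕ.≟ k ⌋

  verts! : Unique verts
  verts! = Unique.filter⁺ (λ x → T? (size≟k x)) (allSubsets-unique n)

  ∈-verts⁻ : ∀ {u} → u ∈ verts → ∣ u ∣ ≡ k
  ∈-verts⁻ u∈ = toWitness (proj₂ (∈-filter⁻ (λ x → T? (size≟k x)) {xs = allSubsets n} u∈))

  ∈-verts⁺ : ∀ {u} → ∣ u ∣ ≡ k → u ∈ verts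
  ∈-verts⁺ {u} ∣u∣≡k = ∈-filter⁺ (λ x → T? (size≟k x)) (∈-allSubsets u) (fromWitness ∣u∣≡k)

  adj-sym : ∀ x y → adj x y ≡ adj y x
  adj-sym x y rewrite Subset.∩-comm x y | ⌊≟⌋-sym _≟V_ x y = refl

  adj-intro : ∀ x y → ∣ x ∩ y ∣ ≡ k′ → x ≢ y → adj x y ≡ true
  adj-intro x y ∣x∩y∣≡k′ x≢y
    rewrite isYes≗does (∣ x ∩ y ∣ ℕ.≟ k′) | dec-true (∣ x ∩ y ∣ ℕ.≟ k′) ∣x∩y∣≡k′ with x ≟V y
  ... | yes x≡y = ⊥-elim (x≢y x≡y)
  ... | no _    = refl

  open SimpleGraph G verts! adj-sym public

  arc-intro : ∀ x y → ∣ x ∣ ≡ k → ∣ y ∣ ≡ k → ∣ x ∩ y ∣ ≡ k′ → x ≢ y → (x , y) ∈ arcs G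
  arc-intro x y ∣x∣≡k ∣y∣≡k ∣x∩y∣≡k′ x≢y = ∈-arcs⁺ (∈-verts⁺ ∣x∣≡k) (∈-verts⁺ ∣y∣≡k) (adj-intro x y ∣x∩y∣≡k′ x≢y)

  neighbourSum-neighbourᵇ : ∀ u → u ∈ verts → ∀ F →
    neighbourSum u F ≡ ∑[ w ∈ allSubsets n ] (if neighbourᵇ u w then F w else 0ℚ)
  neighbourSum-neighbourᵇ u u∈ F = trans (∑-filterᵇ size≟k (allSubsets n) _) (∑-cong′ (allSubsets n) pointwise)
    where
    ∣u∣≡k = ∈-verts⁻ u∈
    pointwise : ∀ w → (if size≟k w then (if adj w u then F w else 0ℚ) else 0ℚ) ≡ (if neighbourᵇ u w then F w else 0ℚ)
    pointwise w rewrite ∣u∣≡k | Subset.∩-comm w u | isYes≗does (∣ w ∣ ℕ.≟ k) | isYes≗does (∣ u ∩ w ∣ ℕ.≟ k′)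
      with ∣ w ∣ ≡ᵇ k
    ... | false = refl
    ... | true with ∣ u ∩ w ∣ ≡ᵇ k′ in ∣u∩w∣≡ᵇk′
    ...   | false = refl
    ...   | true with w ≟V u
    ...     | no _     = refl
    ...     | yes refl = ⊥-elim (ℕ.<⇒≢ (ℕ.n<1+n k′) (begin
      k′                 ≡⟨ ℕ.≡ᵇ⇒≡ _ _ (Equivalence.from Bool.T-≡ ∣u∩w∣≡ᵇk′) ⟨
      ∣ w ∩ w ∣          ≡⟨ ∣p∩p∣≡∣p∣ w ⟩
      ∣ w ∣              ≡⟨ ∣u∣≡k ⟩
      k                  ∎))
      where open ≡-Reasoning

  fromℕ-deg : ∀ u → u ∈ verts → fromℕ (deg G u) ≡ fromℕ k * (fromℕ n - fromℕ k)
  fromℕ-deg u u∈ = begin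
    fromℕ (deg G u)                               ≡⟨ fromℕ-length-filterᵇ (adj u) verts ⟩
    ∑[ w ∈ verts ] (if adj u w then 1ℚ else 0ℚ)   ≡⟨ ∑-cong′ verts (λ w → cong (if_then 1ℚ else 0ℚ) (adj-sym u w)) ⟩
    neighbourSum u (λ _ → 1ℚ)                     ≡⟨ neighbourSum-neighbourᵇ u u∈ (λ _ → 1ℚ) ⟩
    count n (neighbourᵇ u)                        ≡⟨ count-neighbours n u ⟩
    fromℕ ∣ u ∣ * (fromℕ n - fromℕ ∣ u ∣)         ≡⟨ cong (λ a → fromℕ a * (fromℕ n - fromℕ a)) (∈-verts⁻ u∈) ⟩
    fromℕ k * (fromℕ n - fromℕ k)                 ∎
    where open ≡-Reasoning

  φ : Subset n → ℚ
  φ w = fromℕ n * χ (head w) - fromℕ k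

  neighbourSum-φ : ∀ u → u ∈ verts → neighbourSum u φ ≡ (fromℕ k * (fromℕ n - fromℕ k) - fromℕ n) * φ u
  neighbourSum-φ u u∈ = begin
    neighbourSum u φ
      ≡⟨ neighbourSum-neighbourᵇ u u∈ φ ⟩
    ∑[ w ∈ allSubsets n ] (if neighbourᵇ u w then φ w else 0ℚ)
      ≡⟨ ∑-cong′ (allSubsets n) split ⟩
    ∑[ w ∈ allSubsets n ] (fromℕ n * (if neighbourᵇ u w ∧ head w then 1ℚ else 0ℚ) + - (fromℕ k * (if neighbourᵇ u w then 1ℚ else 0ℚ)))
      ≡⟨ trans (∑-+ (allSubsets n) _ _) (cong₂ _+_ (∑-*ˡ (allSubsets n) (fromℕ n) _) (trans (∑-neg (allSubsets n) _) (cong -_ (∑-*ˡ (allSubsets n) (fromℕ k) _)))) ⟩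
    fromℕ n * count n (λ w → neighbourᵇ u w ∧ head w) - fromℕ k * count n (neighbourᵇ u)
      ≡⟨ cong₂ (λ x y → fromℕ n * x - fromℕ k * y) (count-neighbours-∋0 n′ u) (count-neighbours n u) ⟩
    fromℕ n * (if head u then fromℕ (ℕ.pred ∣ u ∣) * (fromℕ n′ - fromℕ (ℕ.pred ∣ u ∣)) else fromℕ ∣ u ∣)
      - fromℕ k * (fromℕ ∣ u ∣ * (fromℕ n - fromℕ ∣ u ∣))
      ≡⟨ eigenvalue-identity u (∈-verts⁻ u∈) ⟩
    (fromℕ k * (fromℕ n - fromℕ k) - fromℕ n) * φ u
      ∎
    where
    open ≡-Reasoning
    open ℚ-Solver.+-*-Solver
    split : ∀ w → (if neighbourᵇ u w then φ w else 0ℚ) ≡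
                  fromℕ n * (if neighbourᵇ u w ∧ head w then 1ℚ else 0ℚ) + - (fromℕ k * (if neighbourᵇ u w then 1ℚ else 0ℚ))
    split w with neighbourᵇ u w | head w
    ... | false | _     = solve 2 (λ a b → con 0ℚ := a :* con 0ℚ :+ :- (b :* con 0ℚ)) refl (fromℕ n) (fromℕ k)
    ... | true  | true  = solve 2 (λ a b → a :* con 1ℚ :- b := a :* con 1ℚ :+ :- (b :* con 1ℚ)) refl (fromℕ n) (fromℕ k)
    ... | true  | false = solve 2 (λ a b → a :* con 0ℚ :- b := a :* con 0ℚ :+ :- (b :* con 1ℚ)) refl (fromℕ n) (fromℕ k)
    eigenvalue-identity : ∀ u → ∣ u ∣ ≡ k →
      fromℕ n * (if head u then fromℕ (ℕ.pred ∣ u ∣) * (fromℕ n′ - fromℕ (ℕ.pred ∣ u ∣)) else fromℕ ∣ u ∣)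
        - fromℕ k * (fromℕ ∣ u ∣ * (fromℕ n - fromℕ ∣ u ∣))
      ≡ (fromℕ k * (fromℕ n - fromℕ k) - fromℕ n) * φ u
    eigenvalue-identity (true ∷ u) ∣u∣≡k rewrite ℕ.suc-injective ∣u∣≡k =
      solve 2 (λ N K → (con 1ℚ :+ N) :* (K :* (N :- K)) :- (con 1ℚ :+ K) :* ((con 1ℚ :+ K) :* ((con 1ℚ :+ N) :- (con 1ℚ :+ K)))
                    := ((con 1ℚ :+ K) :* ((con 1ℚ :+ N) :- (con 1ℚ :+ K)) :- (con 1ℚ :+ N)) :* ((con 1ℚ :+ N) :* con 1ℚ :- (con 1ℚ :+ K)))
              refl (fromℕ n′) (fromℕ k′)
    eigenvalue-identity (false ∷ u) ∣u∣≡k rewrite ∣u∣≡k =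
      solve 2 (λ N K → (con 1ℚ :+ N) :* (con 1ℚ :+ K) :- (con 1ℚ :+ K) :* ((con 1ℚ :+ K) :* ((con 1ℚ :+ N) :- (con 1ℚ :+ K)))
                    := ((con 1ℚ :+ K) :* ((con 1ℚ :+ N) :- (con 1ℚ :+ K)) :- (con 1ℚ :+ N)) :* ((con 1ℚ :+ N) :* con 0ℚ :- (con 1ℚ :+ K)))
              refl (fromℕ n′) (fromℕ k′)

  module _ (k<n : k < n) where

    D : ℕ
    D = k ℕ.* (n ∸ k)

    fromℕ-D : fromℕ D ≡ fromℕ k * (fromℕ n - fromℕ k)
    fromℕ-D = trans (fromℕ-* k (n ∸ k)) (cong (fromℕ k *_) (fromℕ-∸ n k (ℕ.<⇒≤ k<n)))

    deg≡D : ∀ u → u ∈ verts → deg G u ≡ D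
    deg≡D u u∈ = fromℕ-injective (trans (fromℕ-deg u u∈) (sym fromℕ-D))

    D≢0 : D ≢ 0
    D≢0 = ℕ.≢-nonZero⁻¹ D {{ℕ.m*n≢0 k (n ∸ k) {{_}} {{ℕ.>-nonZero (ℕ.m<n⇒0<n∸m k<n)}}}}

    twoOverDeg≡twoOver-D : ∀ u → u ∈ verts → twoOverDeg G u ≡ twoOver D
    twoOverDeg≡twoOver-D u u∈ = trans (twoOverDeg≡twoOver-deg G u) (cong twoOver (deg≡D u u∈))

    μ : ℚ
    μ = twoOver D * (fromℕ D - fromℕ n)

    φ-eigen : ∀ u → u ∈ verts → twoOverDeg G u * neighbourSum u φ ≡ μ * φ u
    φ-eigen u u∈ = begin
      twoOverDeg G u * neighbourSum u φ                               ≡⟨ cong₂ _*_ (twoOverDeg≡twoOver-D u u∈) (neighbourSum-φ u u∈) ⟩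
      twoOver D * ((fromℕ k * (fromℕ n - fromℕ k) - fromℕ n) * φ u)   ≡⟨ cong (λ x → twoOver D * ((x - fromℕ n) * φ u)) (sym fromℕ-D) ⟩
      twoOver D * ((fromℕ D - fromℕ n) * φ u)                         ≡⟨ ℚ.*-assoc (twoOver D) _ (φ u) ⟨
      μ * φ u                                                         ∎
      where open ≡-Reasoning

    integral-μ⇒D∣2n : ℚ.denominator-1 μ ≡ 0 → D ∣ 2 ℕ.* n
    integral-μ⇒D∣2n den≡0 = divides ℤ.∣ + 2 ℤ.- ↥ μ ∣ (begin
      2 ℕ.* n                           ≡⟨ cong ℤ.∣_∣ (fromℤ-injective {b = + (2 ℕ.* n)} (trans fromℤ-lhs (fromℕ≡fromℤ (2 ℕ.* n)))) ⟨
      ℤ.∣ (+ 2 ℤ.- ↥ μ) ℤ.* + D ∣       ≡⟨ ℤ.∣i*j∣≡∣i∣*∣j∣ (+ 2 ℤ.- ↥ μ) (+ D) ⟩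
      ℤ.∣ + 2 ℤ.- ↥ μ ∣ ℕ.* D           ∎)
      where
      open ≡-Reasoning
      open ℚ-Solver.+-*-Solver
      τ = twoOver D
      fromℤ-lhs : fromℤ ((+ 2 ℤ.- ↥ μ) ℤ.* + D) ≡ fromℕ (2 ℕ.* n)
      fromℤ-lhs = begin
        fromℤ ((+ 2 ℤ.- ↥ μ) ℤ.* + D)
          ≡⟨ trans (fromℤ-* (+ 2 ℤ.- ↥ μ) (+ D)) (cong₂ _*_ (fromℤ-- (+ 2) (↥ μ)) (sym (fromℕ≡fromℤ D))) ⟩
        (fromℤ (+ 2) - fromℤ (↥ μ)) * fromℕ D
          ≡⟨ cong (λ x → (fromℤ (+ 2) - x) * fromℕ D) (sym (denominator-1≡0⇒≡fromℤ μ den≡0)) ⟩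
        ((1ℚ + 1ℚ) - τ * (fromℕ D - fromℕ n)) * fromℕ D
          ≡⟨ solve 3 (λ τ d m → ((con 1ℚ :+ con 1ℚ) :- τ :* (d :- m)) :* d := (con 1ℚ :+ con 1ℚ) :* d :- (τ :* d) :* (d :- m)) refl τ (fromℕ D) (fromℕ n) ⟩
        (1ℚ + 1ℚ) * fromℕ D - (τ * fromℕ D) * (fromℕ D - fromℕ n)
          ≡⟨ cong (λ x → (1ℚ + 1ℚ) * fromℕ D - x * (fromℕ D - fromℕ n)) (twoOver-*-fromℕ D D≢0) ⟩
        (1ℚ + 1ℚ) * fromℕ D - (1ℚ + 1ℚ) * (fromℕ D - fromℕ n)
          ≡⟨ solve 2 (λ d m → (con 1ℚ :+ con 1ℚ) :* d :- (con 1ℚ :+ con 1ℚ) :* (d :- m) := (con 1ℚ :+ con 1ℚ) :* m) refl (fromℕ D) (fromℕ n) ⟩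
        (1ℚ + 1ℚ) * fromℕ n
          ≡⟨ fromℕ-* 2 n ⟨
        fromℕ (2 ℕ.* n)
          ∎

prefix : (m j : ℕ) → Subset m
prefix zero    j       = []
prefix (suc m) zero    = false ∷ prefix m zero
prefix (suc m) (suc j) = true ∷ prefix m j

∣prefix∣ : ∀ {m j} → j ≤ m → ∣ prefix m j ∣ ≡ j
∣prefix∣ {zero}  z≤n     = refl
∣prefix∣ {suc m} z≤n     = ∣prefix∣ {m} z≤n
∣prefix∣ {suc m} (s≤s j≤m) = cong suc (∣prefix∣ j≤m)

module WitnessArcs (m k′ : ℕ) (k<n : suc k′ < suc (suc (suc m))) where
  open JohnsonGraph (suc (suc m)) k′ public

  φ[0∈]≢φ[0∉] : fromℕ n * 1ℚ - fromℕ k ≢ fromℕ n * 0ℚ - fromℕ k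
  φ[0∈]≢φ[0∉] eq = ℕ.1+n≢0 (fromℕ-injective {n} {0} (x*1-y≡x*0-y⇒x≡0 (fromℕ n) (fromℕ k) eq))

  arc-with-distinct-φ : ArcWithDistinctEnds φ
  arc-with-distinct-φ =
    (true ∷ false ∷ X , false ∷ true ∷ X) ,
    arc-intro _ _ (cong suc ∣X∣) (cong suc ∣X∣) (trans (∣p∩p∣≡∣p∣ X) ∣X∣) (λ ()) ,
    φ[0∈]≢φ[0∉]
    where
    X = prefix (suc m) k′
    ∣X∣ = ∣prefix∣ (ℕ.≤-pred (ℕ.≤-pred k<n))

arc-with-equal-φ : ∀ m k′ (k<n : suc k′ < suc (suc (suc m))) → let open JohnsonGraph (suc (suc m)) k′ in ArcWithEqualEnds φ
arc-with-equal-φ m zero k<n =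
  (false ∷ true ∷ false ∷ R , false ∷ false ∷ true ∷ R) ,
  arc-intro _ _ (cong suc ∣R∣) (cong suc ∣R∣) (trans (∣p∩p∣≡∣p∣ R) ∣R∣) (λ ()) ,
  refl ,
  λ φ≡0 → ℕ.1+n≢0 (fromℕ-injective {k} {0} (x*0-y≡0⇒y≡0 (fromℕ n) (fromℕ k) φ≡0))
  where
  open WitnessArcs m zero k<n
  R = prefix m 0
  ∣R∣ = ∣prefix∣ {m} z≤n
arc-with-equal-φ m (suc j) k<n =
  (true ∷ true ∷ false ∷ R , true ∷ false ∷ true ∷ R) ,
  arc-intro _ _ (cong (suc ∘ suc) ∣R∣) (cong (suc ∘ suc) ∣R∣) (cong suc (trans (∣p∩p∣≡∣p∣ R) ∣R∣)) (λ ()) ,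
  refl ,
  λ φ≡0 → ℕ.<⇒≢ k<n (sym (fromℕ-injective (x*1-y≡0⇒x≡y (fromℕ n) (fromℕ k) φ≡0)))
  where
  open WitnessArcs m (suc j) k<n
  R = prefix m j
  ∣R∣ = ∣prefix∣ (ℕ.≤-pred (ℕ.≤-pred (ℕ.≤-pred k<n)))

non-integral-μ⇒¬periodic : ∀ m k′ (k<n : suc k′ < suc (suc (suc m))) →
  ℚ.denominator-1 (JohnsonGraph.μ (suc (suc m)) k′ k<n) ≢ 0 → ¬ Periodic (Johnson (suc (suc (suc m))) (suc k′))
non-integral-μ⇒¬periodic m k′ k<n μ∉ℤ =
  non-integral⇒¬periodic μ∉ℤ (arc-with-equal-φ m k′ k<n) arc-with-distinct-φ
  where
  open WitnessArcs m k′ k<n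
  deg≢0 : ∀ u → u ∈ FinGraph.verts G → deg G u ≢ 0
  deg≢0 u u∈ = subst (_≢ 0) (sym (deg≡D k<n u u∈)) (D≢0 k<n)
  open EigenfunctionLift φ (μ k<n) deg≢0 (φ-eigen k<n)

-- The condition k(n − k) ∣ 2n

Listed Exceptional : ℕ → ℕ → Set
Listed      n k = (n , k) ≡ (2 , 1) ⊎ (n , k) ≡ (3 , 1) ⊎ (n , k) ≡ (3 , 2) ⊎ (n , k) ≡ (4 , 2)
Exceptional n k = (n , k) ≡ (9 , 3) ⊎ (n , k) ≡ (8 , 4) ⊎ (n , k) ≡ (9 , 6)

∣2[a+b]⇒≤6 : ∀ {a b} → 1 ≤ a → 1 ≤ b → a ℕ.* b ∣ 2 ℕ.* (a ℕ.+ b) → b ≤ 6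
∣2[a+b]⇒≤6 {A@(suc _)} {B@(suc _)} _ _ AB∣2[A+B] = ℕ.*-cancelˡ-≤ A (begin
  A ℕ.* B                     ≤⟨ ∣⇒≤ AB∣2[A+B] ⟩
  2 ℕ.* (A ℕ.+ B)             ≡⟨ 2[A+B]≡2B+2A ⟩
  2 ℕ.* B ℕ.+ 2 ℕ.* A         ≤⟨ ℕ.+-monoˡ-≤ (2 ℕ.* A) (ℕ.*-monoʳ-≤ 2 B≤2A) ⟩
  2 ℕ.* (2 ℕ.* A) ℕ.+ 2 ℕ.* A ≡⟨ solve 1 (λ A → con 2 :* (con 2 :* A) :+ con 2 :* A := A :* con 6) refl A ⟩
  A ℕ.* 6                     ∎)
  where
  open ℕ.≤-Reasoning
  open ℕ-Solver.+-*-Solver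
  2[A+B]≡2B+2A : 2 ℕ.* (A ℕ.+ B) ≡ 2 ℕ.* B ℕ.+ 2 ℕ.* A
  2[A+B]≡2B+2A = solve 2 (λ A B → con 2 :* (A :+ B) := con 2 :* B :+ con 2 :* A) refl A B
  B≤2A : B ≤ 2 ℕ.* A
  B≤2A = ∣⇒≤ (∣m+n∣m⇒∣n (subst (B ∣_) 2[A+B]≡2B+2A (∣-trans (n∣m*n A) AB∣2[A+B])) (n∣m*n 2))

private
  _≟²_ : DecidableEquality (ℕ × ℕ)
  _≟²_ = Product.≡-dec ℕ._≟_ ℕ._≟_

  listed? : ∀ n k → Dec (Listed n k)
  listed? n k = ((n , k) ≟² _) ⊎-dec ((n , k) ≟² _) ⊎-dec ((n , k) ≟² _) ⊎-dec ((n , k) ≟² _)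

  exceptional? : ∀ n k → Dec (Exceptional n k)
  exceptional? n k = ((n , k) ≟² _) ⊎-dec ((n , k) ≟² _) ⊎-dec ((n , k) ≟² _)

Classified : ℕ → ℕ → Set
Classified n k = 1 ≤ k → k < n → k ℕ.* (n ∸ k) ∣ 2 ℕ.* n → Listed n k ⊎ Exceptional n k

classification-≤12 : ∀ (n : Fin 13) (k : Fin 7) → Classified (toℕ n) (toℕ k)
classification-≤12 = toWitness {a? = all? λ n → all? λ k →
  (_ ℕ.≤? _) →-dec (_ ℕ.<? _) →-dec (_ ∣? _) →-dec (listed? (toℕ n) (toℕ k) ⊎-dec exceptional? (toℕ n) (toℕ k))} _

classification : ∀ n k → Classified n k
classification n k 1≤k k<n D∣2n =
  subst₂ Classified (toℕ-fromℕ< n<13) (toℕ-fromℕ< k<7) (classification-≤12 (fromℕ< n<13) (fromℕ< k<7)) 1≤k k<n D∣2n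
  where
  1≤n∸k = ℕ.m<n⇒0<n∸m k<n
  n≡k+[n∸k] : n ≡ k ℕ.+ (n ∸ k)
  n≡k+[n∸k] = sym (ℕ.m+[n∸m]≡n (ℕ.<⇒≤ k<n))
  D∣2[k+[n∸k]] : k ℕ.* (n ∸ k) ∣ 2 ℕ.* (k ℕ.+ (n ∸ k))
  D∣2[k+[n∸k]] = subst (λ x → k ℕ.* (n ∸ k) ∣ 2 ℕ.* x) n≡k+[n∸k] D∣2n
  n∸k≤6 : n ∸ k ≤ 6
  n∸k≤6 = ∣2[a+b]⇒≤6 1≤k 1≤n∸k D∣2[k+[n∸k]]
  k≤6 : k ≤ 6
  k≤6 = ∣2[a+b]⇒≤6 1≤n∸k 1≤k (subst₂ _∣_ (ℕ.*-comm k (n ∸ k)) (cong (2 ℕ.*_) (ℕ.+-comm k (n ∸ k))) D∣2[k+[n∸k]])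
  k<7 : k < 7
  k<7 = s≤s k≤6
  n<13 : n < 13
  n<13 = s≤s (subst (_≤ 12) (sym n≡k+[n∸k]) (ℕ.+-mono-≤ k≤6 n∸k≤6))

-- The seven remaining graphs

-- ψ lies in the second eigenspace of J(n,k), with adjacency eigenvalue (k − 2)(n − k − 2) − 2;
-- for (n,k) = (9,3), (8,4), (9,6) this gives μ = 2/9, 1/4, 2/9.
ψ : ∀ {n} → Subset (4 ℕ.+ n) → ℚ
ψ (a ∷ b ∷ c ∷ d ∷ _) = (χ a - χ b) * (χ c - χ d)

module _ (n′ k′ : ℕ) (k<n : suc k′ < suc n′) where
  open JohnsonGraph n′ k′
  open FinGraph G using (verts)

  ¬periodic-by-eigenfunction : (η : Subset n → ℚ) (μ : ℚ) → ℚ.denominator-1 μ ≢ 0 →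
    (eigen? : True (All.all? (λ u → twoOverDeg G u * neighbourSum u η ℚ.≟ μ * η u) verts)) →
    ArcWithEqualEnds η → ArcWithDistinctEnds η → ¬ Periodic G
  ¬periodic-by-eigenfunction η μ μ∉ℤ eigen? = non-integral⇒¬periodic μ∉ℤ
    where
    deg≢0 : ∀ u → u ∈ verts → deg G u ≢ 0
    deg≢0 u u∈ = subst (_≢ 0) (sym (deg≡D k<n u u∈)) (D≢0 k<n)
    open EigenfunctionLift η μ deg≢0 (λ u u∈ → All.lookup (toWitness eigen?) u∈)

¬periodic-J[9,3] : ¬ Periodic (Johnson 9 3)
¬periodic-J[9,3] = ¬periodic-by-eigenfunction 8 2 (from-yes (3 ℕ.<? 9)) ψ (+ 2 / 9) (λ ()) _
  ((x , y₁) , arc-intro x y₁ refl refl refl (λ ()) , refl , λ ())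
  ((x , y₂) , arc-intro x y₂ refl refl refl (λ ()) , λ ())
  where
  open JohnsonGraph 8 2
  x y₁ y₂ : Subset 9
  x  = ⁅ # 0 ⁆ ∪ ⁅ # 2 ⁆ ∪ ⁅ # 4 ⁆
  y₁ = ⁅ # 0 ⁆ ∪ ⁅ # 2 ⁆ ∪ ⁅ # 5 ⁆
  y₂ = ⁅ # 1 ⁆ ∪ ⁅ # 2 ⁆ ∪ ⁅ # 4 ⁆

¬periodic-J[8,4] : ¬ Periodic (Johnson 8 4)
¬periodic-J[8,4] = ¬periodic-by-eigenfunction 7 3 (from-yes (4 ℕ.<? 8)) ψ (+ 1 / 4) (λ ()) _
  ((x , y₁) , arc-intro x y₁ refl refl refl (λ ()) , refl , λ ())
  ((x , y₂) , arc-intro x y₂ refl refl refl (λ ()) , λ ())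
  where
  open JohnsonGraph 7 3
  x y₁ y₂ : Subset 8
  x  = ⁅ # 0 ⁆ ∪ ⁅ # 2 ⁆ ∪ ⁅ # 4 ⁆ ∪ ⁅ # 5 ⁆
  y₁ = ⁅ # 0 ⁆ ∪ ⁅ # 2 ⁆ ∪ ⁅ # 4 ⁆ ∪ ⁅ # 6 ⁆
  y₂ = ⁅ # 1 ⁆ ∪ ⁅ # 2 ⁆ ∪ ⁅ # 4 ⁆ ∪ ⁅ # 5 ⁆

¬periodic-J[9,6] : ¬ Periodic (Johnson 9 6)
¬periodic-J[9,6] = ¬periodic-by-eigenfunction 8 5 (from-yes (6 ℕ.<? 9)) ψ (+ 2 / 9) (λ ()) _
  ((x , y₁) , arc-intro x y₁ refl refl refl (λ ()) , refl , λ ())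
  ((x , y₂) , arc-intro x y₂ refl refl refl (λ ()) , λ ())
  where
  open JohnsonGraph 8 5
  x y₁ y₂ : Subset 9
  x  = ⁅ # 0 ⁆ ∪ ⁅ # 2 ⁆ ∪ ⁅ # 4 ⁆ ∪ ⁅ # 5 ⁆ ∪ ⁅ # 6 ⁆ ∪ ⁅ # 7 ⁆
  y₁ = ⁅ # 0 ⁆ ∪ ⁅ # 2 ⁆ ∪ ⁅ # 4 ⁆ ∪ ⁅ # 5 ⁆ ∪ ⁅ # 6 ⁆ ∪ ⁅ # 8 ⁆
  y₂ = ⁅ # 1 ⁆ ∪ ⁅ # 2 ⁆ ∪ ⁅ # 4 ⁆ ∪ ⁅ # 5 ⁆ ∪ ⁅ # 6 ⁆ ∪ ⁅ # 7 ⁆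

module JohnsonPowers (n′ k′ : ℕ) (k<n : suc k′ < suc n′) where
  open JohnsonGraph n′ k′
  open RegularPowers G verts! adj-sym (twoOver (D k<n)) (twoOverDeg≡twoOver-D k<n) public

periodic-J[2,1] : Periodic (Johnson 2 1)
periodic-J[2,1] = JohnsonPowers.periodic-by-computation 1 0 (from-yes (1 ℕ.<? 2)) 2 (s≤s z≤n) _

periodic-J[3,1] : Periodic (Johnson 3 1)
periodic-J[3,1] = JohnsonPowers.periodic-by-computation 2 0 (from-yes (1 ℕ.<? 3)) 3 (s≤s z≤n) _

periodic-J[3,2] : Periodic (Johnson 3 2)
periodic-J[3,2] = JohnsonPowers.periodic-by-computation 2 1 (from-yes (2 ℕ.<? 3)) 3 (s≤s z≤n) _

periodic-J[4,2] : Periodic (Johnson 4 2)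
periodic-J[4,2] = JohnsonPowers.periodic-by-computation 3 1 (from-yes (2 ℕ.<? 4)) 12 (s≤s z≤n) _

listed⇒periodic : ∀ n k → Listed n k → Periodic (Johnson n k)
listed⇒periodic .2 .1 (inj₁ refl)                = periodic-J[2,1]
listed⇒periodic .3 .1 (inj₂ (inj₁ refl))         = periodic-J[3,1]
listed⇒periodic .3 .2 (inj₂ (inj₂ (inj₁ refl)))  = periodic-J[3,2]
listed⇒periodic .4 .2 (inj₂ (inj₂ (inj₂ refl)))  = periodic-J[4,2]

exceptional⇒¬periodic : ∀ n k → Exceptional n k → ¬ Periodic (Johnson n k)
exceptional⇒¬periodic .9 .3 (inj₁ refl)         = ¬periodic-J[9,3]
exceptional⇒¬periodic .8 .4 (inj₂ (inj₁ refl))  = ¬periodic-J[8,4]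
exceptional⇒¬periodic .9 .6 (inj₂ (inj₂ refl))  = ¬periodic-J[9,6]

periodic⇒listed-≥3 : ∀ m k′ (k<n : suc k′ < suc (suc (suc m))) → let n = suc (suc (suc m)) in
  Dec (ℚ.denominator-1 (JohnsonGraph.μ (suc (suc m)) k′ k<n) ≡ 0) → Periodic (Johnson n (suc k′)) → Listed n (suc k′)
periodic⇒listed-≥3 m k′ k<n (no μ∉ℤ)  periodic = ⊥-elim (non-integral-μ⇒¬periodic m k′ k<n μ∉ℤ periodic)
periodic⇒listed-≥3 m k′ k<n (yes μ∈ℤ) periodic =
  [ id , (λ exceptional → ⊥-elim (exceptional⇒¬periodic _ _ exceptional periodic)) ]
    (classification _ _ (s≤s z≤n) k<n (JohnsonGraph.integral-μ⇒D∣2n (suc (suc m)) k′ k<n μ∈ℤ))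

periodic⇒listed : ∀ n k → 1 ≤ k → k < n → Periodic (Johnson n k) → Listed n k
periodic⇒listed 2                   1        _ _   _        = inj₁ refl
periodic⇒listed (suc (suc (suc m))) (suc k′) _ k<n periodic =
  periodic⇒listed-≥3 m k′ k<n (ℚ.denominator-1 (JohnsonGraph.μ (suc (suc m)) k′ k<n) ℕ.≟ 0) periodic
periodic⇒listed 2                   (suc (suc _)) _ (s≤s (s≤s ()))
periodic⇒listed 1                   (suc _)       _ (s≤s ())

theorem1p4 : (n k : ℕ) → 1 ≤ k → k < n →
    Periodic (Johnson n k) ⇔
      ((n , k) ≡ (2 , 1) ⊎ (n , k) ≡ (3 , 1) ⊎ (n , k) ≡ (3 , 2) ⊎ (n , k) ≡ (4 , 2))
theorem1p4 n k 1≤k k<n = mk⇔ (periodic⇒listed n k 1≤k k<n) (listed⇒periodic n k)
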